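{- Let $G$ be a niche-realizable graph. Then each component of the condensation $G^*$ of $G$ is a complete multipartite graph whose partite sets have size at most two, and among these partite sets there is at most one of size one.
   Context: All graphs are simple. A bipartite tournament is an orientation of a complete bipartite graph. The niche graph of a digraph $D$ is the graph with vertex set $V(D)$ in which distinct $u,v$ are adjacent iff there is a vertex $w$ with $(u,w),(v,w)\in A(D)$, or with $(w,u),(w,v)\in A(D)$. A graph is niche-realizable if it is the niche graph of some bipartite tournament. Two vertices of a graph are homogeneous if they have the same closed neighborhood; this is an equivalence relation, and its classes are called critical cliques. The condensation $G^*$ of $G$ is the graph obtained by identifying the vertices within each critical clique of $G$. -}

module Defs where

open import Data.Nat using (ℕ)
open import Data.Fin using (Fin)
open import Data.Bool using (Bool)
open import Data.Product using (Σ; ∃; ∃-syntax; _×_; _,_)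
open import Data.Sum using (_⊎_)
open import Relation.Nullary using (¬_)
open import Relation.Binary.PropositionalEquality using (_≡_; _≢_)
open import Relation.Binary.Construct.Closure.ReflexiveTransitive using (Star)
open import Function.Bundles using (_⇔_)
open import Function.Definitions using (Surjective)

record Graph (n : ℕ) : Set₁ where
  field
    Adj    : Fin n → Fin n → Set
    sym    : ∀ {u v} → Adj u v → Adj v u
    irrefl : ∀ u → ¬ Adj u u
open Graph public

Digraph : ℕ → Set₁
Digraph n = Fin n → Fin n → Set

-- D is a bipartite tournament w.r.t. the bipartition given by 'side':
-- an orientation of the complete bipartite graph with parts side⁻¹(true), side⁻¹(false).
record IsBipartiteTournament {n : ℕ} (side : Fin n → Bool) (D : Digraph n) : Set where
  field
    arc-across : ∀ u v → D u v → side u ≢ side v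
    complete   : ∀ u v → side u ≢ side v → D u v ⊎ D v u
    oriented   : ∀ u v → D u v → ¬ D v u

NicheAdj : {n : ℕ} → Digraph n → Fin n → Fin n → Set
NicheAdj D u v =
  u ≢ v × ((∃[ w ] (D u w × D v w)) ⊎ (∃[ w ] (D w u × D w v)))

IsNicheGraphOf : {n : ℕ} → Graph n → Digraph n → Set
IsNicheGraphOf G D = ∀ u v → Adj G u v ⇔ NicheAdj D u v

NicheRealizable : {n : ℕ} → Graph n → Set₁
NicheRealizable {n} G =
  Σ (Fin n → Bool) λ side → Σ (Digraph n) λ D →
    IsBipartiteTournament side D × IsNicheGraphOf G D

InClosedNbhd : {n : ℕ} → Graph n → Fin n → Fin n → Set
InClosedNbhd G u w = w ≡ u ⊎ Adj G u w

Homogeneous : {n : ℕ} → Graph n → Fin n → Fin n → Set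
Homogeneous G u v = ∀ w → InClosedNbhd G u w ⇔ InClosedNbhd G v w

-- (H, π) is the condensation G* of G: π : V(G) → V(H) is onto, its fibres are
-- exactly the critical cliques of G, and two distinct critical cliques are
-- adjacent in H iff some (equivalently every) pair of their members is adjacent in G.
record IsCondensation {n m : ℕ} (G : Graph n) (H : Graph m) (π : Fin n → Fin m) : Set where
  field
    onto      : Surjective _≡_ _≡_ π
    fibres    : ∀ u v → (π u ≡ π v) ⇔ Homogeneous G u v
    adjacency : ∀ u v → Adj H (π u) (π v) ⇔ (Adj G u v × π u ≢ π v)

InComponent : {m : ℕ} → Graph m → Fin m → Fin m → Set
InComponent H c v = Star (Adj H) c v

record CompleteMultipartite≤2 {m : ℕ} (H : Graph m) (S : Fin m → Set) : Set where
  field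
    k        : ℕ
    part     : Fin m → Fin k
    nonempty : ∀ i → ∃[ v ] (S v × part v ≡ i)
    multipartite : ∀ u v → S u → S v → u ≢ v → Adj H u v ⇔ (part u ≢ part v)
    size≤2   : ∀ i x y z → S x → S y → S z →
               part x ≡ i → part y ≡ i → part z ≡ i →
               x ≡ y ⊎ x ≡ z ⊎ y ≡ z
    atMostOneSingleton : ∀ i j →
               (∃[ x ] (S x × part x ≡ i × (∀ y → S y → part y ≡ i → y ≡ x))) →
               (∃[ x ] (S x × part x ≡ j × (∀ y → S y → part y ≡ j → y ≡ x))) →
               i ≡ j

-- In the niche graph G of a bipartite tournament, adjacent vertices lie on the
-- same side, and if u, v are distinct non-adjacent vertices on one side then every
-- y on the other side satisfies u → y iff y → v (the other orientations make y a
-- common out- or in-neighbour).  So two non-neighbours v, w of u on u's side have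
-- the same in- and out-neighbours, and are homogeneous as soon as the other side is
-- non-empty.  Passing to the twin-free condensation, every vertex has at most one
-- non-neighbour in its component.  Then "equal or non-adjacent" is an equivalence
-- on each component whose classes are the partite sets, of size at most two, and two
-- singleton classes would be homogeneous.

module Submission where

open import Defs hiding (sym)

open import Data.Nat using (ℕ; zero; suc)
open import Data.Fin using (Fin; zero; suc)
open import Data.Fin.Properties using (any?; suc-injective; _≟_)
open import Data.Product using (Σ; ∃-syntax; _×_; _,_; proj₁; proj₂)
open import Data.Empty using (⊥-elim)
open import Relation.Nullary using (¬_; Dec; yes; no)
open import Relation.Nullary.Decidable using (_×-dec_; _⊎-dec_; ¬?; decidable-stable; map; map′)
open import Relation.Binary.PropositionalEquality
  using (_≡_; _≢_; refl; cong; trans; sym; subst; subst₂; ≢-sym)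
open import Relation.Binary.Construct.Closure.ReflexiveTransitive using (Star; ε; _◅_; _◅◅_; fold)
open import Data.Bool using (Bool)
open import Data.Bool.Properties using (¬-not) renaming (_≟_ to _≟ᴮ_)
open import Data.Sum using (_⊎_; inj₁; inj₂; [_,_]′)
open import Function.Bundles using (_⇔_; mk⇔; Equivalence)
open Equivalence using (to; from)
open import Function using (_∘_)
open import Function.Construct.Composition using (_⇔-∘_)
open import Function.Construct.Symmetry using (⇔-sym)
open import Function.Construct.Identity using (⇔-id)

-- Quotients by a decidable equivalence on a decidable subset of Fin m

record IsEquivalenceOn {m : ℕ} (S : Fin m → Set) (R : Fin m → Fin m → Set) : Set where
  field
    reflOn  : ∀ {u} → S u → R u u
    symOn   : ∀ {u v} → S u → S v → R u v → R v u
    transOn : ∀ {u v w} → S u → S v → S w → R u v → R v w → R u w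

record Quotient {m : ℕ} (S : Fin m → Set) (R : Fin m → Fin m → Set) : Set where
  field
    k     : ℕ
    class : ∀ {v} → S v → Fin k
    class-surjective : ∀ i → ∃[ v ] Σ (S v) λ s → class s ≡ i
    class-≡⇔ : ∀ {u v} (su : S u) (sv : S v) → class su ≡ class sv ⇔ R u v

module _ {m : ℕ} {S : Fin (suc m) → Set} {R : Fin (suc m) → Fin (suc m) → Set}
         (equiv : IsEquivalenceOn S R) where
  open IsEquivalenceOn equiv

  private
    S⁺ : Fin m → Set
    S⁺ v = S (suc v)

    R⁺ : Fin m → Fin m → Set
    R⁺ u v = R (suc u) (suc v)

  restrictToSuc : IsEquivalenceOn S⁺ R⁺
  restrictToSuc = record { reflOn = reflOn ; symOn = symOn ; transOn = transOn }

  quotient-zeroRepresented : (S zero → ∃[ w ] S⁺ w × R zero (suc w)) →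
    Quotient S⁺ R⁺ → Quotient S R
  quotient-zeroRepresented rep₀ Q = record
    { k = k
    ; class = classViaRep
    ; class-surjective = surjective
    ; class-≡⇔ = ≡⇔
    }
    where
    open Quotient Q
    rep : ∀ {v} → S v → ∃[ w ] S⁺ w × R v (suc w)
    rep {zero}  s = rep₀ s
    rep {suc v} s = v , s , reflOn s
    classViaRep : ∀ {v} → S v → Fin k
    classViaRep s = class (proj₁ (proj₂ (rep s)))
    surjective : ∀ i → ∃[ v ] Σ (S v) λ s → classViaRep s ≡ i
    surjective i with class-surjective i
    ... | v , s , e = suc v , s , e
    ≡⇔ : ∀ {u v} (su : S u) (sv : S v) → classViaRep su ≡ classViaRep sv ⇔ R u v
    ≡⇔ su sv with rep su | rep sv
    ... | _ , su′ , uRu′ | _ , sv′ , vRv′ = mk⇔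
      (λ e → transOn su su′ sv uRu′
               (transOn su′ sv′ sv (to (class-≡⇔ su′ sv′) e) (symOn sv sv′ vRv′)))
      (λ uRv → from (class-≡⇔ su′ sv′)
        (transOn su′ su sv′ (symOn su su′ uRu′) (transOn su sv sv′ uRv vRv′)))

  quotient-newClass : S zero → ¬ (∃[ w ] S⁺ w × R zero (suc w)) →
    Quotient S⁺ R⁺ → Quotient S R
  quotient-newClass s₀ isolated Q = record
    { k = suc k
    ; class = newClass
    ; class-surjective = surjective
    ; class-≡⇔ = ≡⇔
    }
    where
    open Quotient Q
    newClass : ∀ {v} → S v → Fin (suc k)
    newClass {zero}  _ = zero
    newClass {suc v} s = suc (class s)
    surjective : ∀ i → ∃[ v ] Σ (S v) λ s → newClass s ≡ i
    surjective zero = zero , s₀ , refl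
    surjective (suc i) with class-surjective i
    ... | v , s , e = suc v , s , cong suc e
    ≡⇔ : ∀ {u v} (su : S u) (sv : S v) → newClass su ≡ newClass sv ⇔ R u v
    ≡⇔ {zero}  {zero}  su sv = mk⇔ (λ _ → reflOn su) (λ _ → refl)
    ≡⇔ {zero}  {suc v} su sv = mk⇔ (λ ()) (λ r → ⊥-elim (isolated (v , sv , r)))
    ≡⇔ {suc u} {zero}  su sv = mk⇔ (λ ()) (λ r → ⊥-elim (isolated (u , su , symOn su sv r)))
    ≡⇔ {suc u} {suc v} su sv =
      mk⇔ (to (class-≡⇔ su sv) ∘ suc-injective) (cong suc ∘ from (class-≡⇔ su sv))

  quotient-extend : Dec (S zero) → Dec (∃[ w ] S⁺ w × R zero (suc w)) →
    Quotient S⁺ R⁺ → Quotient S R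
  quotient-extend (no z∉S) _             = quotient-zeroRepresented (⊥-elim ∘ z∉S)
  quotient-extend (yes _)  (yes partner) = quotient-zeroRepresented (λ _ → partner)
  quotient-extend (yes z∈S) (no isolated) = quotient-newClass z∈S isolated

quotient : ∀ {m} {S : Fin m → Set} {R : Fin m → Fin m → Set} →
  (∀ v → Dec (S v)) → (∀ u v → Dec (R u v)) → IsEquivalenceOn S R → Quotient S R
quotient {zero} _ _ _ = record
  { k = 0 ; class = λ { {()} } ; class-surjective = λ () ; class-≡⇔ = λ { {()} } }
quotient {suc m} S? R? equiv =
  quotient-extend equiv (S? zero) (any? (λ w → S? (suc w) ×-dec R? zero (suc w)))
    (quotient (S? ∘ suc) (λ u v → R? (suc u) (suc v)) (restrictToSuc equiv))

-- Components in which every vertex has at most one non-neighbour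

EqOrNonAdj : {m : ℕ} → Graph m → Fin m → Fin m → Set
EqOrNonAdj H u v = u ≡ v ⊎ ¬ Adj H u v

AtMostOneNonNeighbourIn : {m : ℕ} → Graph m → (Fin m → Set) → Set
AtMostOneNonNeighbourIn H S = ∀ {p q r} → S p → S q → S r →
  p ≢ q → p ≢ r → ¬ Adj H p q → ¬ Adj H p r → q ≡ r

TwinFree : {m : ℕ} → Graph m → Set
TwinFree H = ∀ p q → Homogeneous H p q → p ≡ q

WithinTwoSteps : {m : ℕ} → Graph m → Fin m → Fin m → Set
WithinTwoSteps H c v = v ≡ c ⊎ Adj H c v ⊎ ∃[ q ] Adj H c q × Adj H q v

module _ {m : ℕ} (H : Graph m) where

  eqOrNonAdj-sym : ∀ {u v} → EqOrNonAdj H u v → EqOrNonAdj H v u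
  eqOrNonAdj-sym (inj₁ u≡v) = inj₁ (sym u≡v)
  eqOrNonAdj-sym (inj₂ u≁v) = inj₂ (u≁v ∘ Graph.sym H)

  adjacent⇒¬eqOrNonAdj : ∀ {u v} → Adj H u v → ¬ EqOrNonAdj H u v
  adjacent⇒¬eqOrNonAdj u∼v (inj₁ refl) = irrefl H _ u∼v
  adjacent⇒¬eqOrNonAdj u∼v (inj₂ u≁v)  = u≁v u∼v

  distinct⇒nonAdjacent : ∀ {u v} → u ≢ v → EqOrNonAdj H u v → ¬ Adj H u v
  distinct⇒nonAdjacent u≢v (inj₁ u≡v) = ⊥-elim (u≢v u≡v)
  distinct⇒nonAdjacent _   (inj₂ u≁v) = u≁v

  inComponent⇒neighbour : ∀ {c r} → InComponent H c r → c ≢ r → ∃[ x ] Adj H c x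
  inComponent⇒neighbour ε         c≢c = ⊥-elim (c≢c refl)
  inComponent⇒neighbour (c∼x ◅ _) _   = _ , c∼x

  withinTwoSteps⇒inComponent : ∀ {c v} → WithinTwoSteps H c v → InComponent H c v
  withinTwoSteps⇒inComponent (inj₁ refl)                = ε
  withinTwoSteps⇒inComponent (inj₂ (inj₁ c∼v))          = c∼v ◅ ε
  withinTwoSteps⇒inComponent (inj₂ (inj₂ (_ , c∼q , q∼v))) = c∼q ◅ q∼v ◅ ε

module ComponentStructure {m : ℕ} (H : Graph m) (adj? : ∀ u v → Dec (Adj H u v))
  (c : Fin m) (oneNonNeighbour : AtMostOneNonNeighbourIn H (InComponent H c)) where

  private
    C : Fin m → Set
    C = InComponent H c

  eqOrNonAdj-trans : ∀ {q p r} → C q → C p → C r →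
    EqOrNonAdj H q p → EqOrNonAdj H p r → EqOrNonAdj H q r
  eqOrNonAdj-trans {q} {p} {r} cq cp cr qp pr with p ≟ q | p ≟ r
  ... | yes refl | _        = pr
  ... | _        | yes refl = qp
  ... | no p≢q   | no p≢r   = inj₁ (oneNonNeighbour cp cq cr p≢q p≢r
          (distinct⇒nonAdjacent H p≢q (eqOrNonAdj-sym H qp)) (distinct⇒nonAdjacent H p≢r pr))

  withinTwoSteps-step : ∀ {v r} → WithinTwoSteps H c v → Adj H v r → WithinTwoSteps H c r
  withinTwoSteps-step (inj₁ refl)       v∼r = inj₂ (inj₁ v∼r)
  withinTwoSteps-step (inj₂ (inj₁ c∼v)) v∼r = inj₂ (inj₂ (_ , c∼v , v∼r))
  withinTwoSteps-step {v} {r} twoSteps@(inj₂ (inj₂ _)) v∼r with adj? c r | adj? c v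
  ... | yes c∼r | _       = inj₂ (inj₁ c∼r)
  ... | no _    | yes c∼v = inj₂ (inj₂ (_ , c∼v , v∼r))
  ... | no c≁r  | no c≁v  = ⊥-elim (adjacent⇒¬eqOrNonAdj H v∼r
          (eqOrNonAdj-trans cv ε (cv ◅◅ v∼r ◅ ε) (inj₂ (c≁v ∘ Graph.sym H)) (inj₂ c≁r)))
    where
    cv : C v
    cv = withinTwoSteps⇒inComponent H twoSteps

  inComponent⇒withinTwoSteps : ∀ {v} → C v → WithinTwoSteps H c v
  inComponent⇒withinTwoSteps = extend (inj₁ refl)
    where
    extend : ∀ {u v} → WithinTwoSteps H c u → Star (Adj H) u v → WithinTwoSteps H c v
    extend w ε        = w
    extend w (a ◅ as) = extend (withinTwoSteps-step w a) as

  inComponent? : ∀ v → Dec (C v)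
  inComponent? v = map′ (withinTwoSteps⇒inComponent H) inComponent⇒withinTwoSteps
    ((v ≟ c) ⊎-dec (adj? c v ⊎-dec any? (λ q → adj? c q ×-dec adj? q v)))

  eqOrNonAdj-equivalence : IsEquivalenceOn C (EqOrNonAdj H)
  eqOrNonAdj-equivalence = record
    { reflOn  = λ _ → inj₁ refl
    ; symOn   = λ _ _ → eqOrNonAdj-sym H
    ; transOn = eqOrNonAdj-trans
    }

  partition : Quotient C (EqOrNonAdj H)
  partition = quotient inComponent? (λ u v → (u ≟ v) ⊎-dec ¬? (adj? u v)) eqOrNonAdj-equivalence

  open Quotient partition public

  part : Fin m → Fin k
  part v with inComponent? v
  ... | yes cv = class cv
  ... | no _   = class (ε {x = c})  -- junk value outside the component

  part≡class : ∀ {v} (cv : C v) → part v ≡ class cv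
  part≡class {v} cv with inComponent? v
  ... | yes cv′ = from (class-≡⇔ cv′ cv) (inj₁ refl)
  ... | no ¬cv  = ⊥-elim (¬cv cv)

  samePart⇔ : ∀ {u v} → C u → C v → part u ≡ part v ⇔ EqOrNonAdj H u v
  samePart⇔ cu cv = mk⇔
    (λ e → to (class-≡⇔ cu cv) (trans (sym (part≡class cu)) (trans e (part≡class cv))))
    (λ r → trans (part≡class cu) (trans (from (class-≡⇔ cu cv) r) (sym (part≡class cv))))

  multipartite : ∀ u v → C u → C v → u ≢ v → Adj H u v ⇔ (part u ≢ part v)
  multipartite u v cu cv u≢v = mk⇔
    (λ u∼v e → adjacent⇒¬eqOrNonAdj H u∼v (to (samePart⇔ cu cv) e))
    (λ u≁v → decidable-stable (adj? u v) (λ ¬u∼v → u≁v (from (samePart⇔ cu cv) (inj₂ ¬u∼v))))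

  part-size≤2 : ∀ i x y z → C x → C y → C z → part x ≡ i → part y ≡ i → part z ≡ i →
    x ≡ y ⊎ x ≡ z ⊎ y ≡ z
  part-size≤2 i x y z cx cy cz px py pz with x ≟ y | x ≟ z
  ... | yes x≡y | _       = inj₁ x≡y
  ... | no _    | yes x≡z = inj₂ (inj₁ x≡z)
  ... | no x≢y  | no x≢z  = inj₂ (inj₂ (oneNonNeighbour cx cy cz x≢y x≢z
          (nonAdjacent x≢y cy py) (nonAdjacent x≢z cz pz)))
    where
    nonAdjacent : ∀ {w} → x ≢ w → C w → part w ≡ i → ¬ Adj H x w
    nonAdjacent x≢w cw pw =
      distinct⇒nonAdjacent H x≢w (to (samePart⇔ cx cw) (trans px (sym pw)))

  SingletonPart : Fin k → Fin m → Set
  SingletonPart i x = C x × part x ≡ i × (∀ y → C y → part y ≡ i → y ≡ x)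

  closedNbhd-singletonPart : ∀ {i x} → SingletonPart i x → ∀ w → InClosedNbhd H x w ⇔ C w
  closedNbhd-singletonPart {x = x} (cx , px , unique) w = mk⇔ inC inNbhd
    where
    inC : InClosedNbhd H x w → C w
    inC (inj₁ refl) = cx
    inC (inj₂ x∼w)  = cx ◅◅ x∼w ◅ ε
    inNbhd : C w → InClosedNbhd H x w
    inNbhd cw with w ≟ x
    ... | yes w≡x = inj₁ w≡x
    ... | no w≢x  = inj₂ (from (multipartite x w cx cw (w≢x ∘ sym))
                            (λ e → w≢x (unique w cw (trans (sym e) px))))

  singletonPart-unique : TwinFree H → ∀ i j →
    ∃[ x ] SingletonPart i x → ∃[ y ] SingletonPart j y → i ≡ j
  singletonPart-unique twinFree i j (x , sx@(_ , px , _)) (y , sy@(_ , py , _)) =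
    trans (sym px) (trans (cong part x≡y) py)
    where
    x≡y : x ≡ y
    x≡y = twinFree x y λ w →
      ⇔-sym (closedNbhd-singletonPart sy w) ⇔-∘ closedNbhd-singletonPart sx w

completeMultipartite≤2 : {m : ℕ} (H : Graph m) → (∀ u v → Dec (Adj H u v)) → TwinFree H →
  (c : Fin m) → AtMostOneNonNeighbourIn H (InComponent H c) →
  CompleteMultipartite≤2 H (InComponent H c)
completeMultipartite≤2 H adj? twinFree c oneNonNeighbour = record
  { k        = k
  ; part     = part
  ; nonempty = λ i → let (v , cv , e) = class-surjective i in v , cv , trans (part≡class cv) e
  ; multipartite = multipartite
  ; size≤2   = part-size≤2
  ; atMostOneSingleton = singletonPart-unique twinFree
  }
  where open ComponentStructure H adj? c oneNonNeighbour

-- Niche graphs of bipartite tournaments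

SameArcs : {n : ℕ} → Digraph n → Fin n → Fin n → Set
SameArcs D v w = ∀ y → (D v y ⇔ D w y) × (D y v ⇔ D y w)

sameArcs-sym : ∀ {n} {D : Digraph n} {v w} → SameArcs D v w → SameArcs D w v
sameArcs-sym same y = ⇔-sym (proj₁ (same y)) , ⇔-sym (proj₂ (same y))

module NicheGraph {n : ℕ} (G : Graph n) {D : Digraph n} (niche : IsNicheGraphOf G D) where

  closedNbhd-sameArcs : ∀ {v w z} → v ≢ w → Adj G v w → SameArcs D v w →
    InClosedNbhd G v z → InClosedNbhd G w z
  closedNbhd-sameArcs v≢w v∼w same (inj₁ refl) = inj₂ (Graph.sym G v∼w)
  closedNbhd-sameArcs {v} {w} {z} v≢w v∼w same (inj₂ v∼z) with z ≟ w | proj₂ (to (niche v z) v∼z)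
  ... | yes z≡w | _ = inj₁ z≡w
  ... | no z≢w  | inj₁ (y , v→y , z→y) =
    inj₂ (from (niche w z) (≢-sym z≢w , inj₁ (y , to (proj₁ (same y)) v→y , z→y)))
  ... | no z≢w  | inj₂ (y , y→v , y→z) =
    inj₂ (from (niche w z) (≢-sym z≢w , inj₂ (y , to (proj₂ (same y)) y→v , y→z)))

  sameArcs⇒homogeneous : ∀ {v w y} → D v y ⊎ D y v → SameArcs D v w → Homogeneous G v w
  sameArcs⇒homogeneous {v} {w} {y} arc same with v ≟ w
  ... | yes refl = λ _ → ⇔-id _
  ... | no v≢w   = λ z → mk⇔
    (closedNbhd-sameArcs v≢w v∼w same)
    (closedNbhd-sameArcs (≢-sym v≢w) (Graph.sym G v∼w) (sameArcs-sym {D = D} same))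
    where
    v∼w : Adj G v w
    v∼w = from (niche v w) (v≢w , [ (λ v→y → inj₁ (y , v→y , to (proj₁ (same y)) v→y))
                                  , (λ y→v → inj₂ (y , y→v , to (proj₂ (same y)) y→v)) ]′ arc)

module NicheGraphOfBipartiteTournament {n : ℕ} (G : Graph n) {side : Fin n → Bool} {D : Digraph n}
  (bt : IsBipartiteTournament side D) (niche : IsNicheGraphOf G D) where
  open IsBipartiteTournament bt
  open NicheGraph G niche

  arc? : ∀ u v → Dec (D u v)
  arc? u v with side u ≟ᴮ side v
  ... | yes same  = no (λ u→v → arc-across u v u→v same)
  ... | no differ = [ yes , (λ v→u → no (oriented v u v→u)) ]′ (complete u v differ)

  adj? : ∀ u v → Dec (Adj G u v)
  adj? u v = map (⇔-sym (niche u v)) (¬? (u ≟ v) ×-dec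
    (any? (λ w → arc? u w ×-dec arc? v w) ⊎-dec any? (λ w → arc? w u ×-dec arc? w v)))

  adjacent⇒sameSide : ∀ {u v} → Adj G u v → side u ≡ side v
  adjacent⇒sameSide {u} {v} u∼v with proj₂ (to (niche u v) u∼v)
  ... | inj₁ (w , u→w , v→w) =
    trans (¬-not (arc-across u w u→w)) (sym (¬-not (arc-across v w v→w)))
  ... | inj₂ (w , w→u , w→v) =
    trans (¬-not (≢-sym (arc-across w u w→u))) (sym (¬-not (≢-sym (arc-across w v w→v))))

  adjacent⇒otherSide : ∀ {u v} → Adj G u v → ∃[ y ] side y ≢ side u
  adjacent⇒otherSide {u} {v} u∼v with proj₂ (to (niche u v) u∼v)
  ... | inj₁ (w , u→w , _) = w , ≢-sym (arc-across u w u→w)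
  ... | inj₂ (w , w→u , _) = w , arc-across w u w→u

  nonAdjacent⇒reversed : ∀ {u v} → u ≢ v → ¬ Adj G u v → side u ≡ side v →
    ∀ y → D u y ⇔ D y v
  nonAdjacent⇒reversed {u} {v} u≢v u≁v same y = mk⇔ out⇒in in⇒out
    where
    out⇒in : D u y → D y v
    out⇒in u→y with complete y v (λ e → arc-across u y u→y (trans same (sym e)))
    ... | inj₁ y→v = y→v
    ... | inj₂ v→y = ⊥-elim (u≁v (from (niche u v) (u≢v , inj₁ (y , u→y , v→y))))
    in⇒out : D y v → D u y
    in⇒out y→v with complete u y (λ e → arc-across y v y→v (trans (sym e) same))
    ... | inj₁ u→y = u→y
    ... | inj₂ y→u = ⊥-elim (u≁v (from (niche u v) (u≢v , inj₂ (y , y→u , y→v))))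

  commonNonNeighbours⇒sameArcs : ∀ {u v w} → u ≢ v → u ≢ w → ¬ Adj G u v → ¬ Adj G u w →
    side u ≡ side v → side u ≡ side w → SameArcs D v w
  commonNonNeighbours⇒sameArcs {v = v} {w = w} u≢v u≢w u≁v u≁w su≡sv su≡sw y =
    ⇔-sym (reversed-from w u≢w u≁w su≡sw) ⇔-∘ reversed-from v u≢v u≁v su≡sv ,
    nonAdjacent⇒reversed u≢w u≁w su≡sw y ⇔-∘ ⇔-sym (nonAdjacent⇒reversed u≢v u≁v su≡sv y)
    where
    reversed-from : ∀ {u} x → u ≢ x → ¬ Adj G u x → side u ≡ side x → D x y ⇔ D y u
    reversed-from x u≢x u≁x su≡sx =
      nonAdjacent⇒reversed (≢-sym u≢x) (u≁x ∘ Graph.sym G) (sym su≡sx) y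

  commonNonNeighbours⇒homogeneous : ∀ {u v w y} → u ≢ v → u ≢ w → ¬ Adj G u v → ¬ Adj G u w →
    side u ≡ side v → side u ≡ side w → side y ≢ side u → Homogeneous G v w
  commonNonNeighbours⇒homogeneous {v = v} {y = y} u≢v u≢w u≁v u≁w su≡sv su≡sw sy≢su =
    sameArcs⇒homogeneous (complete v y λ e → sy≢su (trans (sym e) (sym su≡sv)))
      (commonNonNeighbours⇒sameArcs u≢v u≢w u≁v u≁w su≡sv su≡sw)

-- Condensations

module Condensation {n m : ℕ} {G : Graph n} {H : Graph m} {π : Fin n → Fin m}
  (cd : IsCondensation G H π) where
  open IsCondensation cd

  pre : Fin m → Fin n
  pre p = proj₁ (onto p)

  π-pre : ∀ p → π (pre p) ≡ p
  π-pre p = proj₂ (onto p) refl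

  pre-injective : ∀ {p q} → pre p ≡ pre q → p ≡ q
  pre-injective {p} {q} e = trans (sym (π-pre p)) (trans (cong π e) (π-pre q))

  adjacent-pre⇔ : ∀ p q → Adj H p q ⇔ (Adj G (pre p) (pre q) × p ≢ q)
  adjacent-pre⇔ p q = subst₂ (λ p′ q′ → Adj H p′ q′ ⇔ (Adj G (pre p) (pre q) × p′ ≢ q′))
    (π-pre p) (π-pre q) (adjacency (pre p) (pre q))

  lift-adj? : (∀ u v → Dec (Adj G u v)) → ∀ p q → Dec (Adj H p q)
  lift-adj? adjG? p q = map (⇔-sym (adjacent-pre⇔ p q)) (adjG? (pre p) (pre q) ×-dec ¬? (p ≟ q))

  adjacent-pre : ∀ {p q} → Adj H p q → Adj G (pre p) (pre q)
  adjacent-pre {p} {q} = proj₁ ∘ to (adjacent-pre⇔ p q)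

  nonAdjacent-pre : ∀ {p q} → p ≢ q → ¬ Adj H p q → ¬ Adj G (pre p) (pre q)
  nonAdjacent-pre {p} {q} p≢q p≁q a = p≁q (from (adjacent-pre⇔ p q) (a , p≢q))

  homogeneous-pre⇒≡ : ∀ {p q} → Homogeneous G (pre p) (pre q) → p ≡ q
  homogeneous-pre⇒≡ {p} {q} h = trans (sym (π-pre p)) (trans (from (fibres _ _) h) (π-pre q))

  closedNbhd-π : ∀ u w → InClosedNbhd G u w ⇔ InClosedNbhd H (π u) (π w)
  closedNbhd-π u w = mk⇔ image preimage
    where
    image : InClosedNbhd G u w → InClosedNbhd H (π u) (π w)
    image (inj₁ refl) = inj₁ refl
    image (inj₂ u∼w) with π w ≟ π u
    ... | yes πw≡πu = inj₁ πw≡πu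
    ... | no πw≢πu  = inj₂ (from (adjacency u w) (u∼w , ≢-sym πw≢πu))
    preimage : InClosedNbhd H (π u) (π w) → InClosedNbhd G u w
    preimage (inj₁ πw≡πu) = to (to (fibres w u) πw≡πu w) (inj₁ refl)
    preimage (inj₂ πu∼πw) = inj₂ (proj₁ (to (adjacency u w) πu∼πw))

  closedNbhd-pre : ∀ p w → InClosedNbhd G (pre p) w ⇔ InClosedNbhd H p (π w)
  closedNbhd-pre p w = subst (λ p′ → InClosedNbhd G (pre p) w ⇔ InClosedNbhd H p′ (π w))
    (π-pre p) (closedNbhd-π (pre p) w)

  twinFree : TwinFree H
  twinFree p q h = homogeneous-pre⇒≡ λ w →
    ⇔-sym (closedNbhd-pre q w) ⇔-∘ (h (π w) ⇔-∘ closedNbhd-pre p w)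

module CondensedNicheGraph {n m : ℕ} {G : Graph n} {side : Fin n → Bool} {D : Digraph n}
  (bt : IsBipartiteTournament side D) (niche : IsNicheGraphOf G D)
  {H : Graph m} {π : Fin n → Fin m} (cd : IsCondensation G H π) where
  open NicheGraphOfBipartiteTournament G bt niche
  open Condensation cd

  condensation-adj? : ∀ p q → Dec (Adj H p q)
  condensation-adj? = lift-adj? adj?

  inComponent⇒sameSide : ∀ {c p} → InComponent H c p → side (pre c) ≡ side (pre p)
  inComponent⇒sameSide = fold (λ a b → side (pre a) ≡ side (pre b))
    (λ a∼b sb≡sc → trans (adjacent⇒sameSide (adjacent-pre a∼b)) sb≡sc) refl

  neighbour⇒otherSide : ∀ {c} → ∃[ x ] Adj H c x → ∃[ y ] side y ≢ side (pre c)
  neighbour⇒otherSide (_ , c∼x) = adjacent⇒otherSide (adjacent-pre c∼x)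

  component-otherSide : ∀ {c p q} → InComponent H c p → InComponent H c q → p ≢ q →
    ∃[ y ] side y ≢ side (pre c)
  component-otherSide {c} {p} cp cq p≢q with c ≟ p
  ... | yes refl = neighbour⇒otherSide (inComponent⇒neighbour H cq p≢q)
  ... | no c≢p   = neighbour⇒otherSide (inComponent⇒neighbour H cp c≢p)

  atMostOneNonNeighbour : ∀ c → AtMostOneNonNeighbourIn H (InComponent H c)
  atMostOneNonNeighbour c {p} {q} {r} cp cq cr p≢q p≢r p≁q p≁r =
    homogeneous-pre⇒≡ (commonNonNeighbours⇒homogeneous
      (p≢q ∘ pre-injective) (p≢r ∘ pre-injective)
      (nonAdjacent-pre p≢q p≁q) (nonAdjacent-pre p≢r p≁r)
      (sameSide cp cq) (sameSide cp cr)
      (proj₂ otherSide))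
    where
    sameSide : ∀ {a b} → InComponent H c a → InComponent H c b → side (pre a) ≡ side (pre b)
    sameSide ca cb = trans (sym (inComponent⇒sameSide ca)) (inComponent⇒sameSide cb)
    otherSide : ∃[ y ] side y ≢ side (pre p)
    otherSide with component-otherSide cp cq p≢q
    ... | y , y≢c = y , λ e → y≢c (trans e (sym (inComponent⇒sameSide cp)))

theorem3p11 : (n : ℕ) (G : Graph n) → NicheRealizable G →
    (m : ℕ) (H : Graph m) (π : Fin n → Fin m) → IsCondensation G H π →
    (c : Fin m) → CompleteMultipartite≤2 H (InComponent H c)
theorem3p11 n G (side , D , bt , niche) m H π cd c =
  completeMultipartite≤2 H condensation-adj? twinFree c (atMostOneNonNeighbour c)
  where
  open Condensation cd
  open CondensedNicheGraph bt niche cd
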